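{- For every formula $\varphi$ of $\mathcal{L}_{\mathcal{U}}$, if $\vdash_{\mathrm{S5}}\varphi$ then $\vdash_{\mathsf{C}}\varphi^\circ$.
   Context: $\mathcal{L}_{\mathcal{U}}$: formulae $\varphi::=p\mid\neg\varphi\mid(\varphi\to\varphi)\mid[\mathsf{U}]\varphi$ over a countably infinite set $\mathit{PROP}$; $\langle\mathsf{U}\rangle\varphi:=\neg[\mathsf{U}]\neg\varphi$. $\vdash_{\mathrm{S5}}$ is derivability in the system with axiom schemata: a complete set of axioms for classical propositional logic; $[\mathsf{U}](\varphi\to\psi)\to([\mathsf{U}]\varphi\to[\mathsf{U}]\psi)$; $[\mathsf{U}]\varphi\to\varphi$; $\langle\mathsf{U}\rangle\varphi\to[\mathsf{U}]\langle\mathsf{U}\rangle\varphi$; and rules Modus Ponens and: if $\vdash\varphi$ then $\vdash[\mathsf{U}]\varphi$. $\mathcal{L}_{\mathsf{C}}$: formulae $\varphi::=p\mid\neg\varphi\mid(\varphi\to\varphi)\mid\mathsf{C}\varphi$; $\wedge,\vee,\leftrightarrow$ usual abbreviations, $\top:=p\vee\neg p$. $\vdash_{\mathsf{C}}$ is derivability in $\mathit{AX}(\mathcal{L}_{\mathsf{C}})$: axiom schemata: a complete set of axioms for classical propositional logic; $\mathsf{C}\top$; $\mathsf{C}\varphi\leftrightarrow\mathsf{C}\neg\varphi$; $\mathsf{C}(\varphi\wedge\mathsf{C}\varphi)$; $\mathsf{C}\varphi\wedge\mathsf{C}\psi\to\mathsf{C}(\varphi\wedge\psi)$; $\varphi\wedge\mathsf{C}\varphi\wedge\mathsf{C}(\varphi\to\psi)\to\mathsf{C}\psi$;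 rules Modus Ponens and: if $\vdash\varphi\leftrightarrow\psi$ then $\vdash\mathsf{C}\varphi\leftrightarrow\mathsf{C}\psi$. Translation $\varphi\mapsto\varphi^\circ$ from $\mathcal{L}_{\mathcal{U}}$ to $\mathcal{L}_{\mathsf{C}}$: $p^\circ=p$; $(\neg\varphi)^\circ=\neg\varphi^\circ$; $(\varphi\to\psi)^\circ=(\varphi^\circ\to\psi^\circ)$; $([\mathsf{U}]\varphi)^\circ=(\varphi^\circ\wedge\mathsf{C}\varphi^\circ)$. -}

module Defs where

open import Data.Nat using (ℕ)

PROP : Set
PROP = ℕ

data FormU : Set where
  pU   : PROP → FormU
  ¬U_  : FormU → FormU
  _⇒U_ : FormU → FormU → FormU
  □U_  : FormU → FormU

◇U_ : FormU → FormU
◇U φ = ¬U (□U (¬U φ))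

data ⊢S5_ : FormU → Set where
  ax1  : ∀ φ ψ → ⊢S5 (φ ⇒U (ψ ⇒U φ))
  ax2  : ∀ φ ψ χ → ⊢S5 ((φ ⇒U (ψ ⇒U χ)) ⇒U ((φ ⇒U ψ) ⇒U (φ ⇒U χ)))
  ax3  : ∀ φ ψ → ⊢S5 (((¬U φ) ⇒U (¬U ψ)) ⇒U (ψ ⇒U φ))
  axK  : ∀ φ ψ → ⊢S5 ((□U (φ ⇒U ψ)) ⇒U ((□U φ) ⇒U (□U ψ)))
  axT  : ∀ φ → ⊢S5 ((□U φ) ⇒U φ)
  ax5  : ∀ φ → ⊢S5 ((◇U φ) ⇒U (□U (◇U φ)))
  mp   : ∀ {φ ψ} → ⊢S5 (φ ⇒U ψ) → ⊢S5 φ → ⊢S5 ψ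
  nec  : ∀ {φ} → ⊢S5 φ → ⊢S5 (□U φ)

data FormC : Set where
  pC   : PROP → FormC
  ¬C_  : FormC → FormC
  _⇒C_ : FormC → FormC → FormC
  C_   : FormC → FormC

_∧C_ : FormC → FormC → FormC
φ ∧C ψ = ¬C (φ ⇒C (¬C ψ))

_∨C_ : FormC → FormC → FormC
φ ∨C ψ = (¬C φ) ⇒C ψ

_⇔C_ : FormC → FormC → FormC
φ ⇔C ψ = (φ ⇒C ψ) ∧C (ψ ⇒C φ)

⊤C : FormC
⊤C = pC 0 ∨C (¬C (pC 0))

data ⊢C_ : FormC → Set where
  ax1   : ∀ φ ψ → ⊢C (φ ⇒C (ψ ⇒C φ))
  ax2   : ∀ φ ψ χ → ⊢C ((φ ⇒C (ψ ⇒C χ)) ⇒C ((φ ⇒C ψ) ⇒C (φ ⇒C χ)))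
  ax3   : ∀ φ ψ → ⊢C (((¬C φ) ⇒C (¬C ψ)) ⇒C (ψ ⇒C φ))
  axC⊤  : ⊢C (C ⊤C)
  axC¬  : ∀ φ → ⊢C ((C φ) ⇔C (C (¬C φ)))
  axCC  : ∀ φ → ⊢C (C (φ ∧C (C φ)))
  axC∧  : ∀ φ ψ → ⊢C (((C φ) ∧C (C ψ)) ⇒C (C (φ ∧C ψ)))
  axCmp : ∀ φ ψ → ⊢C (((φ ∧C (C φ)) ∧C (C (φ ⇒C ψ))) ⇒C (C ψ))
  mp    : ∀ {φ ψ} → ⊢C (φ ⇒C ψ) → ⊢C φ → ⊢C ψ
  re    : ∀ {φ ψ} → ⊢C (φ ⇔C ψ) → ⊢C ((C φ) ⇔C (C ψ))

_° : FormU → FormC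
(pU p) °     = pC p
(¬U φ) °     = ¬C (φ °)
(φ ⇒U ψ) °   = (φ °) ⇒C (ψ °)
(□U φ) °     = (φ °) ∧C (C (φ °))

-- Read φ ∧ C φ as a box ■ φ.  The propositional axioms translate to themselves,
-- so it suffices that ■ obeys K, T, 5 and necessitation in AX(L_C).  For necessitation, a theorem is
-- provably equivalent to ⊤ and C ⊤ is an axiom.  For 5, axiom C(φ ∧ C φ)
-- together with C φ ↔ C ¬φ makes C ¬■ψ a theorem, so ¬■ψ implies its own box.
module Submission where

open import Data.List using (List; []; _∷_)
open import Data.List.Membership.Propositional using (_∈_)
open import Data.List.Relation.Unary.Any using (here; there)
open import Relation.Binary.PropositionalEquality using (refl)

open import Defs

infix 3 _⊢_

data _⊢_ (Γ : List FormC) : FormC → Set where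
  hyp : ∀ {a} → a ∈ Γ → Γ ⊢ a
  thm : ∀ {a} → ⊢C a → Γ ⊢ a
  app : ∀ {a b} → Γ ⊢ (a ⇒C b) → Γ ⊢ a → Γ ⊢ b

⇒-refl : ∀ a → ⊢C (a ⇒C a)
⇒-refl a = mp (mp (ax2 a (a ⇒C a) a) (ax1 a (a ⇒C a))) (ax1 a a)

deduction : ∀ {Γ a b} → (a ∷ Γ) ⊢ b → Γ ⊢ (a ⇒C b)
deduction {a = a} (hyp (here refl)) = thm (⇒-refl a)
deduction {a = a} (hyp (there p))   = app (thm (ax1 _ a)) (hyp p)
deduction {a = a} (thm t)           = app (thm (ax1 _ a)) (thm t)
deduction {a = a} (app {c} {d} f x) =
  app (app (thm (ax2 a c d)) (deduction f)) (deduction x)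

closed : ∀ {a} → [] ⊢ a → ⊢C a
closed (hyp ())
closed (thm t)   = t
closed (app f x) = mp (closed f) (closed x)

hyp₀ : ∀ {Γ a} → (a ∷ Γ) ⊢ a
hyp₀ = hyp (here refl)

hyp₁ : ∀ {Γ a b} → (b ∷ a ∷ Γ) ⊢ a
hyp₁ = hyp (there (here refl))

hyp₂ : ∀ {Γ a b c} → (c ∷ b ∷ a ∷ Γ) ⊢ a
hyp₂ = hyp (there (there (here refl)))

¬-explosion : ∀ a b → ⊢C ((¬C a) ⇒C (a ⇒C b))
¬-explosion a b =
  closed (deduction (app (thm (ax3 b a)) (app (thm (ax1 (¬C a) (¬C b))) hyp₀)))

¬¬-elim : ∀ a → ⊢C ((¬C (¬C a)) ⇒C a)
¬¬-elim a = closed (deduction (app (app (thm (ax3 a (¬C (¬C a)))) ¬a⇒¬³a) hyp₀))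
  where
  ¬a⇒¬³a : (¬C (¬C a) ∷ []) ⊢ (¬C a) ⇒C (¬C (¬C (¬C a)))
  ¬a⇒¬³a = app (thm (ax3 (¬C (¬C (¬C a))) (¬C a)))
           (app (thm (ax1 (¬C (¬C a)) (¬C (¬C (¬C (¬C a)))))) hyp₀)

¬¬-intro : ∀ a → ⊢C (a ⇒C (¬C (¬C a)))
¬¬-intro a = mp (ax3 (¬C (¬C a)) a) (¬¬-elim (¬C a))

contraposition : ∀ a b → ⊢C ((a ⇒C b) ⇒C ((¬C b) ⇒C (¬C a)))
contraposition a b = closed (deduction (app (thm (ax3 (¬C a) (¬C b)))
  (deduction (app (thm (¬¬-intro b)) (app hyp₁ (app (thm (¬¬-elim a)) hyp₀))))))

∧-intro : ∀ a b → ⊢C (a ⇒C (b ⇒C (a ∧C b)))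
∧-intro a b = closed (deduction (deduction
  (app (app (thm (contraposition (a ⇒C (¬C b)) (¬C b)))
            (deduction (app hyp₀ hyp₂)))
       (app (thm (¬¬-intro b)) hyp₀))))

∧-elimˡ : ∀ a b → ⊢C ((a ∧C b) ⇒C a)
∧-elimˡ a b = closed (deduction (app (thm (¬¬-elim a))
  (app (app (thm (contraposition (¬C a) (a ⇒C (¬C b)))) (thm (¬-explosion a (¬C b))))
       hyp₀)))

∧-elimʳ : ∀ a b → ⊢C ((a ∧C b) ⇒C b)
∧-elimʳ a b = closed (deduction (app (thm (¬¬-elim b))
  (app (app (thm (contraposition (¬C b) (a ⇒C (¬C b)))) (thm (ax1 (¬C b) a))) hyp₀)))

∧ᵢ : ∀ {Γ a b} → Γ ⊢ a → Γ ⊢ b → Γ ⊢ (a ∧C b)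
∧ᵢ {a = a} {b} p q = app (app (thm (∧-intro a b)) p) q

∧ₗ : ∀ {Γ a b} → Γ ⊢ (a ∧C b) → Γ ⊢ a
∧ₗ {a = a} {b} p = app (thm (∧-elimˡ a b)) p

∧ᵣ : ∀ {Γ a b} → Γ ⊢ (a ∧C b) → Γ ⊢ b
∧ᵣ {a = a} {b} p = app (thm (∧-elimʳ a b)) p

⊤C-thm : ⊢C ⊤C
⊤C-thm = ⇒-refl (¬C (pC 0))

thm⇒⇔⊤C : ∀ {a} → ⊢C a → ⊢C (a ⇔C ⊤C)
thm⇒⇔⊤C {a} t = closed (∧ᵢ (thm (mp (ax1 ⊤C a) ⊤C-thm)) (thm (mp (ax1 a ⊤C) t)))

C-necessitation : ∀ {a} → ⊢C a → ⊢C (C a)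
C-necessitation t = closed (app (∧ᵣ (thm (re (thm⇒⇔⊤C t)))) (thm axC⊤))

C-¬ : ∀ {a} → ⊢C (C a) → ⊢C (C (¬C a))
C-¬ {a} t = closed (app (∧ₗ (thm (axC¬ a))) (thm t))

■_ : FormC → FormC
■ a = a ∧C (C a)

■-T : ∀ a → ⊢C ((■ a) ⇒C a)
■-T a = ∧-elimˡ a (C a)

■-K : ∀ a b → ⊢C ((■ (a ⇒C b)) ⇒C ((■ a) ⇒C (■ b)))
■-K a b = closed (deduction (deduction
  (∧ᵢ (app (∧ₗ hyp₁) (∧ₗ hyp₀))
      (app (thm (axCmp a b)) (∧ᵢ hyp₀ (∧ᵣ hyp₁))))))

■-necessitation : ∀ {a} → ⊢C a → ⊢C (■ a)
■-necessitation t = closed (∧ᵢ (thm t) (thm (C-necessitation t)))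

C⇒■ : ∀ {a} → ⊢C (C a) → ⊢C (a ⇒C (■ a))
C⇒■ c = closed (deduction (∧ᵢ hyp₀ (thm c)))

■-5 : ∀ a → ⊢C ((¬C (■ (¬C a))) ⇒C (■ (¬C (■ (¬C a)))))
■-5 a = C⇒■ (C-¬ (axCC (¬C a)))

lemma7p4 : (φ : FormU) → ⊢S5 φ → ⊢C (φ °)
lemma7p4 _ (ax1 φ ψ)   = ax1 (φ °) (ψ °)
lemma7p4 _ (ax2 φ ψ χ) = ax2 (φ °) (ψ °) (χ °)
lemma7p4 _ (ax3 φ ψ)   = ax3 (φ °) (ψ °)
lemma7p4 _ (axK φ ψ)   = ■-K (φ °) (ψ °)
lemma7p4 _ (axT φ)     = ■-T (φ °)
lemma7p4 _ (ax5 φ)     = ■-5 (φ °)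
lemma7p4 _ (mp d e)    = mp (lemma7p4 _ d) (lemma7p4 _ e)
lemma7p4 _ (nec d)     = ■-necessitation (lemma7p4 _ d)
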